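{- Let $\mathbb P$ be a large-tree forcing notion. Then $\mathbb P\times_{\mathsf E_0}\mathbb P$ forces $x_{\mathrm{left}}\not\mathrel{\mathsf E_0}x_{\mathrm{right}}$, where $\langle x_{\mathrm{left}},x_{\mathrm{right}}\rangle$ is the generic pair of reals, i.e. the pair with $\langle x_{\mathrm{left}},x_{\mathrm{right}}\rangle\in[T]\times[T']$ for every $\langle T,T'\rangle$ in the generic filter.
   Context: $a\,\mathsf E_0\,b$ iff $a(n)=b(n)$ for all but finitely many $n$. For $s,t\in 2^{<\omega}$ with $\mathrm{lh}(s)\le\mathrm{lh}(t)$, $s\cdot t$ has length $\mathrm{lh}(t)$ with $(s\cdot t)(k)=t(k)+s(k)\bmod2$ for $k<\mathrm{lh}(s)$, $=t(k)$ otherwise; if $\mathrm{lh}(s)>\mathrm{lh}(t)$, $s\cdot t=(s{\restriction}\mathrm{lh}(t))\cdot t$; $s\cdot T=\{s\cdot t:t\in T\}$; $T{\restriction}s=\{t\in T:s\subseteq t\lor t\subseteq s\}$; $[T]$ is the set of infinite branches of $T$. The stem of a perfect tree $T$ is the largest $s\in T$ with $T=T{\restriction}s$. $\mathbf{LT}$ is the set of perfect trees $T\subseteq2^{<\omega}$ for which there are nonempty strings $q^m_i$ ($m<\omega,i<2$) with $\mathrm{lh}(q^m_0)=\mathrm{lh}(q^m_1)$, $q^m_i(0)=i$, such that $T$ consists of all initial segments of strings $\mathrm{stem}(T)^\frown q^0_{i(0)}{}^\frown\cdots{}^\frown q^m_{i(m)}$. A large-tree forcing notion is a set $\mathbb P\subseteq\mathbf{LT}$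 closed under $T\mapsto T{\restriction}u$ ($u\in T$) and $T\mapsto s\cdot T$ ($s\in2^{<\omega}$). $\mathbb P\times_{\mathsf E_0}\mathbb P$ is the set of pairs $\langle T,T'\rangle$ of trees in $\mathbb P$ with $T'=\sigma\cdot T$ for some $\sigma\in2^{<\omega}$, ordered componentwise by inclusion. -}

module Defs where

open import Data.Bool using (Bool; true; false; _xor_)
open import Data.Nat using (ℕ; zero; suc; _+_)
open import Data.List using (List; []; _∷_; _++_; length)
open import Data.Product using (Σ; _×_; _,_; ∃)
open import Data.Sum using (_⊎_)
open import Data.Empty using (⊥)
open import Relation.Binary.PropositionalEquality using (_≡_)
open import Relation.Nullary using (¬_)
open import Level using (Level; 0ℓ) renaming (suc to lsuc)

-- Finite binary strings 2^{<ω} are lists of booleans (position 0 = head);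
-- reals 2^ω are functions ℕ → Bool.

Str : Set
Str = List Bool

Real : Set
Real = ℕ → Bool

_↾ₙ_ : Real → ℕ → Str
a ↾ₙ zero  = []
a ↾ₙ suc n = a 0 ∷ ((λ k → a (suc k)) ↾ₙ n)

_⊑_ : Str → Str → Set
s ⊑ t = ∃ λ r → s ++ r ≡ t

E₀ : Real → Real → Set
E₀ a b = ∃ λ n → ∀ k → a (n + k) ≡ b (n + k)

_·_ : Str → Str → Str
[]      · t       = t
(x ∷ s) · []      = []
(x ∷ s) · (y ∷ t) = (x xor y) ∷ (s · t)

-- Trees: subsets of 2^{<ω}, given as predicates; equality of trees is
-- extensional equality of the predicates.

Tree : Set₁
Tree = Str → Set

_⊆ᵀ_ : Tree → Tree → Set
T ⊆ᵀ S = ∀ u → T u → S u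

_≐_ : Tree → Tree → Set
T ≐ S = (T ⊆ᵀ S) × (S ⊆ᵀ T)

Branch : Tree → Real → Set
Branch T a = ∀ n → T (a ↾ₙ n)

_·ᵀ_ : Str → Tree → Tree
(s ·ᵀ T) u = ∃ λ t → T t × (s · t ≡ u)

_↾ᵀ_ : Tree → Str → Tree
(T ↾ᵀ u) v = T v × (u ⊑ v ⊎ v ⊑ u)

-- concatenation  q^0_{i(0)} ⌢ ... ⌢ q^m_{i(m)}  (here: first (suc m) blocks)
blocks : (ℕ → Bool → Str) → (ℕ → Bool) → ℕ → Str
blocks q i zero    = q 0 (i 0)
blocks q i (suc m) = q 0 (i 0) ++ blocks (λ k → q (suc k)) (λ k → i (suc k)) m

_⇔′_ : Set → Set → Set
A ⇔′ B = (A → B) × (B → A)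

-- LT : T is generated from stem s by the blocks q^m_i as in the paper.
-- (Such a T is automatically perfect with stem s, since q^0_0, q^0_1 are
-- nonempty and differ at their first bit.)
record IsLT (T : Tree) : Set where
  field
    stem  : Str
    q     : ℕ → Bool → Str
    first : ∀ m i → Σ Str (λ r → q m i ≡ i ∷ r)
    sameLength : ∀ m → length (q m false) ≡ length (q m true)
    generated  : ∀ u → T u ⇔′ (∃ λ m → ∃ λ (i : ℕ → Bool) → u ⊑ (stem ++ blocks q i m))

-- A large-tree forcing notion, as a set of trees (closed under ≐ since
-- trees are represented by predicates).
record LargeTreeForcing (P : Tree → Set) : Set₁ where
  field
    respects   : ∀ {T S} → T ≐ S → P T → P S
    inLT       : ∀ {T} → P T → IsLT T
    closed-↾   : ∀ {T} u → P T → T u → P (T ↾ᵀ u)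
    closed-·   : ∀ {T} s → P T → P (s ·ᵀ T)

module Product (P : Tree → Set) where

  record Cond : Set₁ where
    constructor ⟨_,_,_,_,_,_⟩
    field
      left   : Tree
      right  : Tree
      leftP  : P left
      rightP : P right
      σ      : Str
      shift  : right ≐ (σ ·ᵀ left)
  open Cond public

  _≤_ : Cond → Cond → Set
  p ≤ q = (left p ⊆ᵀ left q) × (right p ⊆ᵀ right q)

  DenseBelow : Cond → (Cond → Set) → Set₁
  DenseBelow p D = ∀ q → q ≤ p → ∃ λ r → r ≤ q × D r

  -- Formulas of the forcing language about the generic pair ⟨x_left,x_right⟩
  -- (atomic: x_left(k) = x_right(k)).
  data Form : Set where
    eqAt : ℕ → Form
    neg  : Form → Form
    all  : (ℕ → Form) → Form

  DecidesEq : ℕ → Cond → Set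
  DecidesEq k r = ∃ λ (i : Bool) →
    (∀ a → Branch (left r) a → a k ≡ i) × (∀ b → Branch (right r) b → b k ≡ i)

  -- the standard (weak) forcing relation
  _⊩_ : Cond → Form → Set₁
  p ⊩ eqAt k = DenseBelow p (DecidesEq k)
  p ⊩ neg φ  = ∀ q → q ≤ p → ¬ (q ⊩ φ)
  p ⊩ all f  = ∀ n → p ⊩ f n

  -- x_left E₀ x_right  :=  ∃ n ∀ k x_left(n+k) = x_right(n+k),  with ∃ = ¬∀¬
  E₀-generic : Form
  E₀-generic = neg (all λ n → neg (all λ k → eqAt (n + k)))

  Forces : Form → Set₁
  Forces φ = ∀ p → p ⊩ φ

module Submission where

-- It suffices to show that every condition s forces
-- "for every n there is k with x_left(n+k) ≠ x_right(n+k)", i.e. that no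
-- extension of s can force x_left and x_right to agree beyond n.  This
-- rests on a splitting lemma: every s has an extension s' and some k ≥ n
-- such that all branches of left s' have bit 0 at k while all branches of
-- right s' have bit 1 at k.  No extension of such an s' decides the two
-- bits equally, because the trees of a condition (being large trees) do
-- have branches.
--
-- To split s = ⟨T , σ·T⟩ we restrict T to a node u = stem ⌢ q⁰₀ ⌢ … ⌢ qⁿ₀,
-- whose bit k at the start of the block qⁿ₀ is 0, and choose the shift ρ of
-- the right tree so that ρ(k) = 1.  Then ρ·(T↾u) ⊆ σ·T holds either with
-- ρ = σ (when σ(k) = 1), or with ρ = σ ⊕ c where c swaps block qⁿ₀ for qⁿ₁
-- and so maps T↾u into T.

open import Defs
open import Data.Bool using (Bool; true; false; _xor_)
open import Data.Bool.Properties using (xor-assoc; xor-identityʳ)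
open import Data.Nat using (ℕ; zero; suc; _+_; _∸_; _<_; _≤_; _≤′_; ≤′-refl; ≤′-step; z≤n; s≤s)
open import Data.Nat.Properties using (≤-trans; n<1+n; n≤1+n; m<m+n; m≤n+m; m+[n∸m]≡n; suc-injective; ≤⇒≤′)
open import Data.List using (List; []; _∷_; _++_; length; replicate)
open import Data.List.Properties using (++-assoc; ++-identityʳ; length-++; length-++-≤ʳ; length-replicate; ∷-injective)
open import Data.Product using (Σ; _×_; _,_; ∃; proj₁; proj₂)
open import Data.Sum using (_⊎_; inj₁; inj₂)
open import Data.Empty using (⊥)
open import Relation.Binary.PropositionalEquality
open import Relation.Nullary using (¬_)

⊑-refl : ∀ s → s ⊑ s
⊑-refl s = [] , ++-identityʳ s

[]⊑ : ∀ s → [] ⊑ s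
[]⊑ s = s , refl

⊑-trans : ∀ {a b c} → a ⊑ b → b ⊑ c → a ⊑ c
⊑-trans {a} (r , refl) (r' , refl) = r ++ r' , sym (++-assoc a r r')

∷-⊑ : ∀ {x y s t} → x ≡ y → s ⊑ t → (x ∷ s) ⊑ (y ∷ t)
∷-⊑ refl (r , refl) = r , refl

++-⊑ : ∀ w {s t} → s ⊑ t → (w ++ s) ⊑ (w ++ t)
++-⊑ w {s} (r , refl) = r , ++-assoc w s r

++-split : ∀ {A A' B B' : Str} → length A ≡ length A' → A ++ B ≡ A' ++ B' → A ≡ A' × B ≡ B'
++-split {[]} {[]} _ e = refl , e
++-split {x ∷ A} {y ∷ A'} l e with ∷-injective e
... | refl , e' with ++-split {A} {A'} (suc-injective l) e'
... | refl , e'' = refl , e''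

-- Bits of strings (missing positions read as 0).

bitAt : Str → ℕ → Bool
bitAt []      _       = false
bitAt (x ∷ s) zero    = x
bitAt (x ∷ s) (suc k) = bitAt s k

bitAt-⊑ : ∀ {s t} k → s ⊑ t → k < length s → bitAt s k ≡ bitAt t k
bitAt-⊑ {x ∷ s} zero    (r , refl) _       = refl
bitAt-⊑ {x ∷ s} (suc k) (r , refl) (s≤s p) = bitAt-⊑ {s} k (r , refl) p

bitAt-comparable : ∀ {s t} k → s ⊑ t ⊎ t ⊑ s → k < length s → k < length t → bitAt s k ≡ bitAt t k
bitAt-comparable {s} {t} k (inj₁ s⊑t) p _ = bitAt-⊑ {s} {t} k s⊑t p
bitAt-comparable {s} {t} k (inj₂ t⊑s) _ q = sym (bitAt-⊑ {t} {s} k t⊑s q)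

bitAt-++ : ∀ s t → bitAt (s ++ t) (length s) ≡ bitAt t 0
bitAt-++ []      t = refl
bitAt-++ (x ∷ s) t = bitAt-++ s t

bitAt-after-zeros : ∀ m d → bitAt (replicate m false ++ d) m ≡ bitAt d 0
bitAt-after-zeros zero    d = refl
bitAt-after-zeros (suc m) d = bitAt-after-zeros m d

bitAt-↾ : ∀ (a : Real) {n} k → k < n → bitAt (a ↾ₙ n) k ≡ a k
bitAt-↾ a zero    (s≤s _) = refl
bitAt-↾ a (suc k) (s≤s p) = bitAt-↾ (λ j → a (suc j)) k p

length-↾ : ∀ (a : Real) n → length (a ↾ₙ n) ≡ n
length-↾ a zero    = refl
length-↾ a (suc n) = cong suc (length-↾ (λ j → a (suc j)) n)

branch-bit : ∀ (a : Real) {u} k → u ⊑ (a ↾ₙ suc k) ⊎ (a ↾ₙ suc k) ⊑ u → k < length u → a k ≡ bitAt u k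
branch-bit a {u} k cmp k<u = begin
  a k                       ≡⟨ bitAt-↾ a k (n<1+n k) ⟨
  bitAt (a ↾ₙ suc k) k      ≡⟨ bitAt-comparable {u} k cmp k<u k<a↾ ⟨
  bitAt u k                 ∎
  where
  open ≡-Reasoning
  k<a↾ : k < length (a ↾ₙ suc k)
  k<a↾ = subst (k <_) (sym (length-↾ a (suc k))) (n<1+n k)

length-· : ∀ r t → length (r · t) ≡ length t
length-· []      t       = refl
length-· (x ∷ r) []      = refl
length-· (x ∷ r) (y ∷ t) = cong suc (length-· r t)

bitAt-· : ∀ r t k → k < length t → bitAt (r · t) k ≡ bitAt r k xor bitAt t k
bitAt-· []      t       k       _       = refl
bitAt-· (x ∷ r) (y ∷ t) zero    _       = refl
bitAt-· (x ∷ r) (y ∷ t) (suc k) (s≤s p) = bitAt-· r t k p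

·-mono : ∀ c {s t} → s ⊑ t → (c · s) ⊑ (c · t)
·-mono []      p          = p
·-mono (x ∷ c) {[]}    _  = []⊑ _
·-mono (x ∷ c) {y ∷ s} (r , refl) = ∷-⊑ refl (·-mono c (r , refl))

_⊕_ : Str → Str → Str
[]      ⊕ t       = t
(x ∷ s) ⊕ []      = x ∷ s
(x ∷ s) ⊕ (y ∷ t) = (x xor y) ∷ (s ⊕ t)

bitAt-⊕ : ∀ s t k → bitAt (s ⊕ t) k ≡ bitAt s k xor bitAt t k
bitAt-⊕ []      t       k       = refl
bitAt-⊕ (x ∷ s) []      k       = sym (xor-identityʳ _)
bitAt-⊕ (x ∷ s) (y ∷ t) zero    = refl
bitAt-⊕ (x ∷ s) (y ∷ t) (suc k) = bitAt-⊕ s t k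

⊕-· : ∀ s c t → (s ⊕ c) · t ≡ s · (c · t)
⊕-· []      c       t       = refl
⊕-· (x ∷ s) []      t       = refl
⊕-· (x ∷ s) (y ∷ c) []      = refl
⊕-· (x ∷ s) (y ∷ c) (z ∷ t) = cong₂ _∷_ (xor-assoc x y z) (⊕-· s c t)

zeros-· : ∀ X d Y → (replicate (length X) false ++ d) · (X ++ Y) ≡ X ++ (d · Y)
zeros-· []      d Y = refl
zeros-· (x ∷ X) d Y = cong (x ∷_) (zeros-· X d Y)

swap-· : ∀ a b R → length a ≡ length b → (a · b) · (a ++ R) ≡ b ++ R
swap-· []      []      R _ = refl
swap-· (x ∷ a) (y ∷ b) R l = cong₂ _∷_ (cancel x y) (swap-· a b R (suc-injective l))
  where
  cancel : ∀ x y → (x xor y) xor x ≡ y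
  cancel false false = refl
  cancel false true  = refl
  cancel true  false = refl
  cancel true  true  = refl

swap-block : ∀ {X X' a a'} b R → length X ≡ length X' → length a ≡ length a' → length a ≡ length b →
             (X ++ a) ⊑ (X' ++ a' ++ R) →
             (replicate (length X) false ++ (a · b)) · (X' ++ a' ++ R) ≡ X' ++ b ++ R
swap-block {X} {X'} {a} {a'} b R lX la lb (r , e)
  with ++-split {X} {X'} lX (trans (sym (++-assoc X a r)) e)
... | refl , e' with ++-split {a} {a'} la e'
... | refl , _ = trans (zeros-· X (a · b) (a ++ R)) (cong (X ++_) (swap-· a b R lb))

chain-limit : (w : ℕ → Str) → (∀ m → w m ⊑ w (suc m)) → (∀ m → m ≤ length (w m)) →
              ∃ λ (a : Real) → ∀ n → (a ↾ₙ n) ⊑ w n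
chain-limit w step long = a , λ n → ↾-⊑ a n (w n) (long n) (agree n)
  where
  a : Real
  a k = bitAt (w (suc k)) k

  ↾-⊑ : ∀ (b : Real) n v → n ≤ length v → (∀ k → k < n → b k ≡ bitAt v k) → (b ↾ₙ n) ⊑ v
  ↾-⊑ b zero    v       _       _  = []⊑ v
  ↾-⊑ b (suc n) (x ∷ v) (s≤s p) ag =
    ∷-⊑ (ag 0 (s≤s z≤n)) (↾-⊑ (λ j → b (suc j)) n v p (λ k k<n → ag (suc k) (s≤s k<n)))

  mono : ∀ {m m'} → m ≤′ m' → w m ⊑ w m'
  mono ≤′-refl      = ⊑-refl _
  mono (≤′-step p)  = ⊑-trans (mono p) (step _)

  agree : ∀ n k → k < n → a k ≡ bitAt (w n) k
  agree n k k<n = bitAt-⊑ k (mono (≤⇒≤′ k<n)) (long (suc k))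

path : (ℕ → Bool → Str) → List Bool → Str
path q []       = []
path q (b ∷ bs) = q 0 b ++ path (λ k → q (suc k)) bs

blocks≡path : ∀ q i m → blocks q i m ≡ path q (i ↾ₙ suc m)
blocks≡path q i zero    = sym (++-identityʳ (q 0 (i 0)))
blocks≡path q i (suc m) = cong (q 0 (i 0) ++_) (blocks≡path (λ k → q (suc k)) (λ k → i (suc k)) m)

path-mono : ∀ q {bs cs} → bs ⊑ cs → path q bs ⊑ path q cs
path-mono q {[]}     _          = []⊑ _
path-mono q {b ∷ bs} (r , refl) = ++-⊑ (q 0 b) (path-mono (λ k → q (suc k)) {bs} (r , refl))

path-split : ∀ q bs₀ b bs₁ →
  path q (bs₀ ++ b ∷ bs₁) ≡ path q bs₀ ++ (q (length bs₀) b ++ path (λ k → q (suc (length bs₀ + k))) bs₁)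
path-split q []        b bs₁ = refl
path-split q (c ∷ bs₀) b bs₁ =
  trans (cong (q 0 c ++_) (path-split (λ k → q (suc k)) bs₀ b bs₁)) (sym (++-assoc (q 0 c) _ _))

path-length-≥ : ∀ (q : ℕ → Bool → Str) → (∀ m b → Σ Str λ r → q m b ≡ b ∷ r) →
                ∀ bs → length bs ≤ length (path q bs)
path-length-≥ q fs []       = z≤n
path-length-≥ q fs (b ∷ bs) with fs 0 b
... | r , e rewrite e =
  s≤s (≤-trans (path-length-≥ (λ k → q (suc k)) (λ m → fs (suc m)) bs) (length-++-≤ʳ _ {r}))

block-length : ∀ (q : ℕ → Bool → Str) → (∀ m → length (q m false) ≡ length (q m true)) →
               ∀ m b c → length (q m b) ≡ length (q m c)
block-length q sl m false false = refl
block-length q sl m false true  = sl m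
block-length q sl m true  false = sym (sl m)
block-length q sl m true  true  = refl

path-length-cong : ∀ (q : ℕ → Bool → Str) → (∀ m → length (q m false) ≡ length (q m true)) →
                   ∀ {bs cs} → length bs ≡ length cs → length (path q bs) ≡ length (path q cs)
path-length-cong q sl {[]}     {[]}     _ = refl
path-length-cong q sl {b ∷ bs} {c ∷ cs} l = begin
  length (q 0 b ++ path qs bs)            ≡⟨ length-++ (q 0 b) ⟩
  length (q 0 b) + length (path qs bs)    ≡⟨ cong₂ _+_ (block-length q sl 0 b c)
                                                 (path-length-cong qs (λ m → sl (suc m)) {bs} {cs} (suc-injective l)) ⟩
  length (q 0 c) + length (path qs cs)    ≡⟨ length-++ (q 0 c) ⟨
  length (q 0 c ++ path qs cs)            ∎
  where
  open ≡-Reasoning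
  qs = λ k → q (suc k)

⊑-choices : ∀ bs n → length bs ≤ n → bs ⊑ (bitAt bs ↾ₙ n)
⊑-choices []       n       _       = []⊑ _
⊑-choices (b ∷ bs) (suc n) (s≤s p) = ∷-⊑ refl (⊑-choices bs n p)

cut-at : ∀ j bs → j < length bs →
         Σ (List Bool) λ bs₀ → Σ Bool λ b → Σ (List Bool) λ bs₁ → (bs ≡ bs₀ ++ b ∷ bs₁) × (length bs₀ ≡ j)
cut-at zero    (b ∷ bs) _       = [] , b , bs , refl , refl
cut-at (suc j) (c ∷ bs) (s≤s p) with cut-at j bs p
... | bs₀ , b , bs₁ , e , l = c ∷ bs₀ , b , bs₁ , cong (c ∷_) e , cong suc l

replicate-⊑ : ∀ n → replicate n false ⊑ replicate (suc n) false
replicate-⊑ zero    = []⊑ _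
replicate-⊑ (suc n) = ∷-⊑ refl (replicate-⊑ n)

module LargeTree {T : Tree} (lt : IsLT T) where
  open IsLT lt

  node⇒path : ∀ {t} → T t → ∃ λ bs → t ⊑ (stem ++ path q bs)
  node⇒path {t} Tt with proj₁ (generated t) Tt
  ... | m , i , t⊑ = i ↾ₙ suc m , subst (λ w → t ⊑ (stem ++ w)) (blocks≡path q i m) t⊑

  path⇒node : ∀ {t} bs → t ⊑ (stem ++ path q bs) → T t
  path⇒node {t} bs t⊑ = proj₂ (generated t) (length bs , bitAt bs , ⊑-trans t⊑ path⊑)
    where
    path⊑ : (stem ++ path q bs) ⊑ (stem ++ blocks q (bitAt bs) (length bs))
    path⊑ = subst (λ w → (stem ++ path q bs) ⊑ (stem ++ w)) (sym (blocks≡path q (bitAt bs) (length bs)))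
                  (++-⊑ stem (path-mono q (⊑-choices bs (suc (length bs)) (n≤1+n (length bs)))))

  path∈T : ∀ bs → T (stem ++ path q bs)
  path∈T bs = path⇒node bs (⊑-refl _)

  downward-closed : ∀ {v w} → T v → w ⊑ v → T w
  downward-closed Tv w⊑v with node⇒path Tv
  ... | bs , v⊑ = path⇒node bs (⊑-trans w⊑v v⊑)

  node-at : ∀ {j} bs₀ b bs₁ → length bs₀ ≡ j →
            stem ++ path q (bs₀ ++ b ∷ bs₁) ≡ (stem ++ path q bs₀) ++ (q j b ++ path (λ k → q (suc (j + k))) bs₁)
  node-at bs₀ b bs₁ refl = trans (cong (stem ++_) (path-split q bs₀ b bs₁)) (sym (++-assoc stem _ _))

  choices≤node : ∀ bs → length bs ≤ length (stem ++ path q bs)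
  choices≤node bs = ≤-trans (path-length-≥ q first bs) (length-++-≤ʳ _ {stem})

  -- The leftmost branch stem ⌢ q⁰₀ ⌢ q¹₀ ⌢ … shows that T has a branch.
  branch : ∃ λ a → Branch T a
  branch with chain-limit leftmost (λ m → ++-⊑ stem (path-mono q (replicate-⊑ m))) long
    where
    leftmost : ℕ → Str
    leftmost m = stem ++ path q (replicate m false)
    long : ∀ m → m ≤ length (leftmost m)
    long m = subst (_≤ length (leftmost m)) (length-replicate m) (choices≤node (replicate m false))
  ... | a , a⊑ = a , λ n → path⇒node (replicate n false) (a⊑ n)

  -- Fix a choice list Z and let j = lh(Z).  The shift `swap` exchanges the
  -- block qʲ₀ after X = stem ⌢ path q Z for qʲ₁; it maps T↾(X ⌢ qʲ₀) into T.
  module Swap (Z : List Bool) where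
    j = length Z
    X = stem ++ path q Z
    u = X ++ q j false

    swap : Str
    swap = replicate (length X) false ++ (q j false · q j true)

    u∈T : T u
    u∈T = path⇒node (Z ++ false ∷ []) (subst (u ⊑_) u≡ (⊑-refl u))
      where
      u≡ : u ≡ stem ++ path q (Z ++ false ∷ [])
      u≡ = begin
        X ++ q j false                          ≡⟨ cong (X ++_) (++-identityʳ (q j false)) ⟨
        X ++ (q j false ++ [])                  ≡⟨ ++-assoc stem (path q Z) _ ⟩
        stem ++ (path q Z ++ (q j false ++ [])) ≡⟨ cong (stem ++_) (path-split q Z false []) ⟨
        stem ++ path q (Z ++ false ∷ [])        ∎
        where open ≡-Reasoning

    j≤X : j ≤ length X
    j≤X = choices≤node Z

    X<u : length X < length u
    X<u with first j false
    ... | r , e = subst (length X <_) (sym (length-++ X))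
                        (m<m+n (length X) (subst (0 <_) (cong length (sym e)) (s≤s z≤n)))

    bitAt-u : bitAt u (length X) ≡ false
    bitAt-u with first j false
    ... | r , e rewrite e = bitAt-++ X (false ∷ r)

    bitAt-swap : bitAt swap (length X) ≡ true
    bitAt-swap with first j false | first j true
    ... | r , e | r' , e' rewrite e | e' = bitAt-after-zeros (length X) (true ∷ (r · r'))

    -- For u ⊑ t ∈ T: pad the choices of t beyond level j, cut them at level j,
    -- and exchange the j-th block by swap-block.
    swap-above : ∀ t → T t → u ⊑ t → T (swap · t)
    swap-above t Tt u⊑t with node⇒path Tt
    ... | bs , t⊑ with cut-at j (bs ++ replicate (suc j) false) long
      where
      long : j < length (bs ++ replicate (suc j) false)
      long = subst (j <_) (sym (trans (length-++ bs) (cong (length bs +_) (length-replicate (suc j)))))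
                   (m≤n+m (suc j) (length bs))
    ... | bs₀ , b , bs₁ , e , l =
      downward-closed swapped (subst (λ w → (swap · t) ⊑ (swap · w)) W≡ (·-mono swap t⊑W))
      where
      X' = stem ++ path q bs₀
      R = path (λ k → q (suc (j + k))) bs₁
      W≡ : stem ++ path q (bs₀ ++ b ∷ bs₁) ≡ X' ++ q j b ++ R
      W≡ = node-at bs₀ b bs₁ l
      t⊑W : t ⊑ (stem ++ path q (bs₀ ++ b ∷ bs₁))
      t⊑W = ⊑-trans t⊑ (++-⊑ stem (path-mono q (subst (bs ⊑_) e (replicate (suc j) false , refl))))
      lX : length X ≡ length X'
      lX = trans (length-++ stem)
                 (trans (cong (length stem +_) (path-length-cong q sameLength {Z} {bs₀} (sym l)))
                        (sym (length-++ stem)))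
      u⊑W : u ⊑ (X' ++ q j b ++ R)
      u⊑W = subst (u ⊑_) W≡ (⊑-trans u⊑t t⊑W)
      swapped : T (swap · (X' ++ q j b ++ R))
      swapped = subst T (sym (swap-block {X} {X'} {q j false} {q j b} (q j true) R
                                          lX (block-length q sameLength j false b) (sameLength j) u⊑W))
                        (subst T (node-at bs₀ true bs₁ l) (path∈T (bs₀ ++ true ∷ bs₁)))

    swap-into : ∀ t → (T ↾ᵀ u) t → T (swap · t)
    swap-into t (Tt , inj₁ u⊑t) = swap-above t Tt u⊑t
    swap-into t (Tt , inj₂ t⊑u) = downward-closed (swap-above u u∈T (⊑-refl u)) (·-mono swap t⊑u)

module Splitting (P : Tree → Set) (L : LargeTreeForcing P) where
  open LargeTreeForcing L
  open Product P renaming (_≤_ to _≼_)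

  ≐-refl : ∀ {T} → T ≐ T
  ≐-refl = (λ _ x → x) , (λ _ x → x)

  ≼-refl : ∀ {s} → s ≼ s
  ≼-refl = (λ _ x → x) , (λ _ x → x)

  Separates : ℕ → Cond → Set
  Separates k s = (∀ a → Branch (left s) a → a k ≡ false) × (∀ b → Branch (right s) b → b k ≡ true)

  restrict : (s : Cond) (u : Str) → left s u → Str → Cond
  restrict s u Tu c =
    ⟨ left s ↾ᵀ u , (σ s ⊕ c) ·ᵀ (left s ↾ᵀ u) , P↾u , closed-· (σ s ⊕ c) P↾u , σ s ⊕ c , ≐-refl ⟩
    where
    P↾u = closed-↾ u (leftP s) Tu

  restrict-≼ : ∀ s u Tu c → (∀ t → (left s ↾ᵀ u) t → left s (c · t)) → restrict s u Tu c ≼ s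
  restrict-≼ s u Tu c into =
    (λ _ → proj₁) , λ { _ (t , t∈ , refl) → proj₂ (shift s) _ (c · t , into t t∈ , sym (⊕-· (σ s) c t)) }

  restrict-separates : ∀ s u Tu c k → k < length u → bitAt u k ≡ false → bitAt (σ s ⊕ c) k ≡ true →
                       Separates k (restrict s u Tu c)
  restrict-separates s u Tu c k k<u u0 ρ1 = leftBit , rightBit
    where
    ρ = σ s ⊕ c
    leftBit : ∀ a → Branch (left s ↾ᵀ u) a → a k ≡ false
    leftBit a a∈ = trans (branch-bit a k (proj₂ (a∈ (suc k))) k<u) u0
    rightBit : ∀ b → Branch (ρ ·ᵀ (left s ↾ᵀ u)) b → b k ≡ true
    rightBit b b∈ with b∈ (suc k)
    ... | t , (_ , cmp) , ρt≡ = begin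
      b k                      ≡⟨ bitAt-↾ b k (n<1+n k) ⟨
      bitAt (b ↾ₙ suc k) k     ≡⟨ cong (λ w → bitAt w k) ρt≡ ⟨
      bitAt (ρ · t) k          ≡⟨ bitAt-· ρ t k k<t ⟩
      bitAt ρ k xor bitAt t k  ≡⟨ cong₂ _xor_ ρ1 (trans (sym (bitAt-comparable {u} k cmp k<u k<t)) u0) ⟩
      true xor false           ≡⟨ refl ⟩
      true                     ∎
      where
      open ≡-Reasoning
      k<t : k < length t
      k<t = subst (k <_) (trans (sym (length-↾ b (suc k))) (trans (cong length (sym ρt≡)) (length-· ρ t)))
                  (n<1+n k)

  splitting : ∀ s n → Σ Cond λ s' → s' ≼ s × Σ ℕ λ k → Separates (n + k) s'
  splitting s n = separate-with shift-choice
    where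
    open LargeTree (inLT (leftP s))
    open Swap (replicate n false)

    Result = Σ Cond λ s' → s' ≼ s × Σ ℕ λ k → Separates (n + k) s'

    Good : Str → Set
    Good c = (∀ t → (left s ↾ᵀ u) t → left s (c · t)) × bitAt (σ s ⊕ c) (length X) ≡ true

    separate-with : Σ Str Good → Result
    separate-with (c , into , ρ1) =
      restrict s u u∈T c , restrict-≼ s u u∈T c into , length X ∸ n ,
      subst (λ k → Separates k (restrict s u u∈T c)) (sym (m+[n∸m]≡n n≤X))
            (restrict-separates s u u∈T c (length X) X<u bitAt-u ρ1)
      where
      n≤X : n ≤ length X
      n≤X = subst (_≤ length X) (length-replicate n) j≤X

    -- If σ already has bit 1 at lh X no shift is needed, otherwise swap the block.
    shift-choice : Σ Str Good
    shift-choice with bitAt (σ s) (length X) in eq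
    ... | true  = [] , (λ _ → proj₁) , trans (bitAt-⊕ (σ s) [] (length X)) (cong (_xor false) eq)
    ... | false = swap , swap-into , trans (bitAt-⊕ (σ s) swap (length X)) (cong₂ _xor_ eq bitAt-swap)

  -- No extension of a separating condition decides the two bits alike,
  -- since both of its trees have branches.
  separated-undecided : ∀ k s r → Separates k s → r ≼ s → ¬ DecidesEq k r
  separated-undecided k s r (left0 , right1) (r⊆ˡ , r⊆ʳ) (i , leftI , rightI)
    with LargeTree.branch (inLT (leftP r)) | LargeTree.branch (inLT (rightP r))
  ... | a , a∈ | b , b∈ = false≢true (begin
    false  ≡⟨ left0 a (λ m → r⊆ˡ _ (a∈ m)) ⟨
    a k    ≡⟨ leftI a a∈ ⟩
    i      ≡⟨ rightI b b∈ ⟨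
    b k    ≡⟨ right1 b (λ m → r⊆ʳ _ (b∈ m)) ⟩
    true   ∎)
    where
    open ≡-Reasoning
    false≢true : false ≡ true → ⊥
    false≢true ()

  differ-beyond : ∀ s n → s ⊩ neg (all λ k → eqAt (n + k))
  differ-beyond _ n s₁ _ forces-agreement with splitting s₁ n
  ... | s' , s'≼s₁ , k , sep with forces-agreement k s' s'≼s₁
  ... | r , r≼s' , decides = separated-undecided (n + k) s' r sep r≼s' decides

corollary5p4 : (P : Tree → Set) → LargeTreeForcing P →
    Product.Forces P (Product.neg (Product.E₀-generic P))
corollary5p4 P L _ q _ q⊩¬differ = q⊩¬differ q (≼-refl {q}) (differ-beyond q)
  where
  open Splitting P L
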